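{- Let $\mathcal G=(P,\mathcal L)$ be a partial euclidean geometry and let $\mathrm{Levi}\,\mathcal G=(P\cup\mathcal L,E)$ be its Levi graph. If $\mathcal G$ is connected and $\mathrm{mindeg}\,\mathcal G\ge2$, then: (i) $\mathrm{Levi}\,\mathcal G$ is closed; (ii) $\mathrm{Fl}\,\mathrm{Levi}\,\mathcal G=\{P\cup\mathcal L,\emptyset\}\cup\{\{x\}\mid x\in P\cup\mathcal L\}\cup\{L\mid L\in\mathcal L\}\cup\{\mathcal L(p)\mid p\in P\}$; (iii) $\mathrm{Fl}\,\mathrm{Levi}\,\mathcal G$ satisfies the Jordan–Dedekind condition.
   Context: A partial euclidean geometry (PEG) is a pair $(P,\mathcal L)$ with $P$ a finite nonempty set, $\mathcal L$ a nonempty subset of $2^P$, $P\cap 2^P=\emptyset$, such that: every point lies in some line ($P\subseteq\bigcup\mathcal L$); distinct lines $L,L'$ satisfy $|L\cap L'|\le1$; and $|L|\ge2$ for every $L\in\mathcal L$. For $p\in P$, $\mathcal L(p)$ is the set of lines containing $p$. The Levi graph $\mathrm{Levi}\,\mathcal G$ has vertex set $P\cup\mathcal L$ and edges $\{p,L\}$ for $L\in\mathcal L$, $p\in L$ (a line $L$ is thus a set of vertices of the Levi graph). $\mathrm{mindeg}\,\mathcal G$ is the minimum vertex degree of $\mathrm{Levi}\,\mathcal G$. $\mathcal G$ is connected if there is no nontrivial partition $\mathcal L=\mathcal L_1\cup\mathcal L_2$ with $(\bigcup\mathcal L_1)\cap(\bigcup\mathcal L_2)=\emptyset$. For a graph $H=(U,F)$: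 $\mathrm{St}(u)$ is the set of neighbours of $u$, $\mathrm{St}(W)=\bigcap_{w\in W}\mathrm{St}(w)$ with $\mathrm{St}(\emptyset)=U$, and $\mathrm{Fl}\,H=\{\mathrm{St}(W)\mid W\subseteq U\}$ ordered by inclusion; a vertex $u$ is closed if $\{u\}\in\mathrm{Fl}\,H$, and $H$ is closed if all its vertices are. A finite lattice satisfies the Jordan–Dedekind condition if all its maximal chains have the same length. -}

module Defs where

open import Data.Nat using (ℕ; _≤_)
open import Data.Bool using (Bool; true; false; T)
open import Data.Fin using (Fin)
import Data.Fin as F
open import Data.Fin.Subset using (Subset; _∈_; _∩_; ∣_∣)
open import Data.Vec using (lookup; tabulate)
open import Data.Sum using (_⊎_; inj₁; inj₂)
open import Data.Sum.Properties using (≡-dec)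
open import Data.Product using (Σ; ∃; ∃-syntax; _×_; _,_)
open import Data.List using (List; length)
open import Data.List.Relation.Unary.All using (All)
open import Data.List.Relation.Unary.Any using (Any)
open import Data.List.Relation.Unary.Linked using (Linked)
open import Relation.Nullary using (¬_; does)
open import Relation.Binary.PropositionalEquality using (_≡_; _≢_)
open import Function.Bundles using (_⇔_)

-- Partial euclidean geometry with point set P = Fin n and line set
-- indexed by Fin m; line L is the subset  line L  of P.
-- Points are vertices inj₁ p, lines are vertices inj₂ L of the Levi graph,
-- so P ∩ 2^P = ∅ holds by construction.

record PEG (n m : ℕ) : Set where
  field
    line          : Fin m → Subset n
    -- ℒ is a *set* of subsets: distinct indices give distinct lines
    line-inj      : ∀ L L' → L ≢ L' → line L ≢ line L'
    P-nonempty    : 1 ≤ n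
    ℒ-nonempty    : 1 ≤ m
    covered       : ∀ (p : Fin n) → ∃[ L ] (p ∈ line L)
    meet≤1        : ∀ L L' → L ≢ L' → ∣ line L ∩ line L' ∣ ≤ 1
    line≥2        : ∀ L → 2 ≤ ∣ line L ∣

module _ {n m : ℕ} (G : PEG n m) where
  open PEG G

  V : Set
  V = Fin n ⊎ Fin m

  pencil : Fin n → Subset m
  pencil p = tabulate (λ L → lookup (line L) p)

  adj : V → V → Bool
  adj (inj₁ p) (inj₂ L) = lookup (line L) p
  adj (inj₂ L) (inj₁ p) = lookup (line L) p
  adj (inj₁ _) (inj₁ _) = false
  adj (inj₂ _) (inj₂ _) = false

  degree : V → ℕ
  degree (inj₁ p) = ∣ pencil p ∣
  degree (inj₂ L) = ∣ line L ∣

  MindegAtLeast2 : Set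
  MindegAtLeast2 = ∀ (v : V) → 2 ≤ degree v

  -- connectedness: no nontrivial partition ℒ = ℒ₁ ∪ ℒ₂ (ℒ₁ = {L | S L = true},
  -- ℒ₂ = {L | S L = false}) with (⋃ℒ₁) ∩ (⋃ℒ₂) = ∅
  Connected : Set
  Connected = ¬ (Σ (Fin m → Bool) λ S →
                   (∃[ L ] S L ≡ true) × (∃[ L ] S L ≡ false) ×
                   (∀ (p : Fin n) (L₁ L₂ : Fin m) → S L₁ ≡ true → S L₂ ≡ false →
                      p ∈ line L₁ → p ∈ line L₂ → Data.Empty.⊥))
    where import Data.Empty

  VSet : Set
  VSet = V → Bool

  _≐_ : VSet → VSet → Set
  X ≐ Y = ∀ v → X v ≡ Y v

  _⊆V_ : VSet → VSet → Set
  X ⊆V Y = ∀ v → T (X v) → T (Y v)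

  _⊂V_ : VSet → VSet → Set
  X ⊂V Y = X ⊆V Y × ¬ (Y ⊆V X)

  -- membership in St(W) = ⋂_{w ∈ W} St(w)   (St(∅) = V)
  InSt : VSet → V → Set
  InSt W v = ∀ w → T (W w) → T (adj w v)

  IsFlat : VSet → Set
  IsFlat X = Σ VSet λ W → ∀ v → (T (X v) ⇔ InSt W v)

  _≟V_ : (u v : V) → Relation.Nullary.Dec (u ≡ v)
  _≟V_ = ≡-dec F._≟_ F._≟_
    where import Relation.Nullary

  fullSet : VSet
  fullSet _ = true

  emptySet : VSet
  emptySet _ = false

  singleton : V → VSet
  singleton u v = does (u ≟V v)

  lineSet : Fin m → VSet
  lineSet L (inj₁ p) = lookup (line L) p
  lineSet L (inj₂ _) = false

  pencilSet : Fin n → VSet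
  pencilSet p (inj₁ _) = false
  pencilSet p (inj₂ L) = lookup (line L) p

  LeviClosed : Set
  LeviClosed = ∀ (u : V) → IsFlat (singleton u)

  FlDescription : Set
  FlDescription = ∀ (X : VSet) → IsFlat X ⇔
    ( X ≐ fullSet ⊎ X ≐ emptySet ⊎ (∃[ x ] X ≐ singleton x)
    ⊎ (∃[ L ] X ≐ lineSet L) ⊎ (∃[ p ] X ≐ pencilSet p))

  IsChain : List VSet → Set
  IsChain c = All IsFlat c × Linked _⊂V_ c

  IsMaximalChain : List VSet → Set
  IsMaximalChain c = IsChain c ×
    (∀ Y → IsFlat Y → All (λ X → X ⊆V Y ⊎ Y ⊆V X) c → Any (λ X → X ≐ Y) c)

  JordanDedekind : Set
  JordanDedekind = ∀ c c' → IsMaximalChain c → IsMaximalChain c' → length c ≡ length c'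

-- The whole argument runs through four properties of the Levi graph, proved
-- first from the axioms: adjacency is irreflexive and symmetric, two distinct
-- vertices have at most one common neighbour (two lines share at most one
-- point), and, as mindeg ≥ 2, every vertex has two distinct neighbours.
--
-- (i), (ii).  The sets V, ∅, {x} = St(St(x)) and St(x) (the line x or the
-- pencil ℒ(x)) are flats.  Conversely a flat St(W) is V if W = ∅, St(w) if
-- W = {w}, and has at most one element if W contains two distinct vertices,
-- so it is ∅ or a singleton.
--
-- (iii).  Give these shapes the ranks 0 (∅), 1 ({x}), 2 (St x), 3 (V).  An
-- inclusion of flats raises the rank, strictly unless they coincide, and
-- between flats of ranks r < s lies a flat of rank r + 1.  Hence a maximal
-- chain starts at rank 0, climbs by exactly one rank per step and ends at
-- rank 3: every maximal chain has length 4.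
module Submission where

open import Defs
open import Data.Nat using (ℕ; suc; _+_; _≤_; _<_; z≤n; s≤s)
open import Data.Nat.Properties
  using (≤-trans; ≤-reflexive; <⇒≤; <⇒≱; m≤n⇒m<n∨m≡n; n≤0⇒n≡0; +-suc; +-identityʳ)
open import Data.Bool using (Bool; true; false; T)
open import Data.Bool.Properties using (T?; T-≡)
open import Data.Unit using (tt)
open import Data.Empty using (⊥; ⊥-elim)
open import Data.Fin using (Fin; zero; suc; fromℕ<) renaming (_≟_ to _≟ᶠ_)
open import Data.Fin.Properties using (any?; suc-injective)
open import Data.Fin.Subset using (Subset; _∈_; _∩_; ∣_∣)
open import Data.Fin.Subset.Properties using (x∈p∩q⁺; x∈p⇒∣p-x∣<∣p∣; x∈p∧x≢y⇒x∈p-y)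
open import Data.Vec using (_∷_; lookup)
open import Data.Vec.Properties using (lookup⇒[]=; lookup∘tabulate)
open import Data.Sum using (_⊎_; inj₁; inj₂)
open import Data.Sum.Properties using (inj₁-injective; inj₂-injective)
open import Data.Product using (Σ; ∃; _×_; _,_; proj₁; proj₂)
open import Data.List using (List; []; _∷_; length)
open import Data.List.Relation.Unary.All using (All; []; _∷_; lookupWith; universal)
import Data.List.Relation.Unary.All as All
open import Data.List.Relation.Unary.Any using (Any; here; there)
open import Data.List.Relation.Unary.Linked using (Linked; [-]; _∷_)
open import Data.List.Relation.Unary.Linked.Properties using (Linked⇒All)
open import Relation.Nullary using (¬_; Dec; yes; no)
open import Relation.Nullary.Decidable using (_×-dec_; ¬?; decidable-stable)
open import Relation.Binary.PropositionalEquality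
  using (_≡_; _≢_; refl; sym; trans; cong; subst; module ≡-Reasoning)
open import Function using (_∘_)
open import Function.Bundles using (_⇔_; mk⇔; Equivalence)
open Equivalence using (to; from)

T-ext : ∀ {a b : Bool} → (T a → T b) → (T b → T a) → a ≡ b
T-ext {false} {false} _ _ = refl
T-ext {false} {true}  _ b⇒a = ⊥-elim (b⇒a tt)
T-ext {true}  {false} a⇒b _ = ⊥-elim (a⇒b tt)
T-ext {true}  {true}  _ _ = refl

member : ∀ {k} (s : Subset k) → 1 ≤ ∣ s ∣ → ∃ λ i → T (lookup s i)
member (true ∷ s)  _ = zero , tt
member (false ∷ s) h with member s h
... | i , i∈s = suc i , i∈s

twoMembers : ∀ {k} (s : Subset k) → 2 ≤ ∣ s ∣ →
             Σ (Fin k) λ i → Σ (Fin k) λ j → i ≢ j × T (lookup s i) × T (lookup s j)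
twoMembers (true ∷ s) (s≤s h) with member s h
... | j , j∈s = zero , suc j , (λ ()) , tt , j∈s
twoMembers (false ∷ s) h with twoMembers s h
... | i , j , i≢j , i∈s , j∈s = suc i , suc j , (λ e → i≢j (suc-injective e)) , i∈s , j∈s

T⇒∈ : ∀ {k} {s : Subset k} {i} → T (lookup s i) → i ∈ s
T⇒∈ {s = s} {i} t = lookup⇒[]= i s (to T-≡ t)

member⇒1≤ : ∀ {k} {s : Subset k} {i} → i ∈ s → 1 ≤ ∣ s ∣
member⇒1≤ i∈s = ≤-trans (s≤s z≤n) (x∈p⇒∣p-x∣<∣p∣ i∈s)

twoMembers⇒2≤ : ∀ {k} {s : Subset k} {i j} → i ≢ j → i ∈ s → j ∈ s → 2 ≤ ∣ s ∣
twoMembers⇒2≤ i≢j i∈s j∈s =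
  ≤-trans (s≤s (member⇒1≤ (x∈p∧x≢y⇒x∈p-y j∈s (λ e → i≢j (sym e))))) (x∈p⇒∣p-x∣<∣p∣ i∈s)

module Levi {n m : ℕ} (G : PEG n m) (mindeg : MindegAtLeast2 G) where
  open PEG G

  Vertex : Set
  Vertex = V G

  Adj : Vertex → Vertex → Set
  Adj u v = T (adj G u v)

  _⊆_ : VSet G → VSet G → Set
  _⊆_ = _⊆V_ G

  _⊂_ : VSet G → VSet G → Set
  _⊂_ = _⊂V_ G

  _≃_ : VSet G → VSet G → Set
  _≃_ = _≐_ G

  adj-irrefl : ∀ v → ¬ Adj v v
  adj-irrefl (inj₁ _) ()
  adj-irrefl (inj₂ _) ()

  adj-sym : ∀ u v → Adj u v → Adj v u
  adj-sym (inj₁ _) (inj₂ _) a = a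
  adj-sym (inj₂ _) (inj₁ _) a = a
  adj-sym (inj₁ _) (inj₁ _) ()
  adj-sym (inj₂ _) (inj₂ _) ()

  lineThrough-unique : ∀ {p q L L'} → p ≢ q →
    T (lookup (line L) p) → T (lookup (line L) q) →
    T (lookup (line L') p) → T (lookup (line L') q) → L ≡ L'
  lineThrough-unique {p} {q} {L} {L'} p≢q pL qL pL' qL' with L ≟ᶠ L'
  ... | yes L≡L' = L≡L'
  ... | no L≢L' = ⊥-elim (<⇒≱ (s≤s (s≤s z≤n)) (≤-trans two≤meet (meet≤1 L L' L≢L')))
    where
      two≤meet : 2 ≤ ∣ line L ∩ line L' ∣
      two≤meet = twoMembers⇒2≤ {s = line L ∩ line L'} p≢q
        (x∈p∩q⁺ (T⇒∈ pL , T⇒∈ pL')) (x∈p∩q⁺ (T⇒∈ qL , T⇒∈ qL'))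

  -- Two distinct vertices have at most one common neighbour; for two points
  -- this is the previous lemma, for two lines its contrapositive.
  commonNeighbour-unique : ∀ {u u'} v v' → u ≢ u' →
    Adj u v → Adj u' v → Adj u v' → Adj u' v' → v ≡ v'
  commonNeighbour-unique {inj₁ _} {inj₁ _} (inj₂ _) (inj₂ _) u≢u' uv u'v uv' u'v' =
    cong inj₂ (lineThrough-unique (λ e → u≢u' (cong inj₁ e)) uv u'v uv' u'v')
  commonNeighbour-unique {inj₂ _} {inj₂ _} (inj₁ p) (inj₁ q) u≢u' uv u'v uv' u'v'
    with p ≟ᶠ q
  ... | yes p≡q = cong inj₁ p≡q
  ... | no p≢q = ⊥-elim (u≢u' (cong inj₂ (lineThrough-unique p≢q uv uv' u'v u'v')))
  commonNeighbour-unique {inj₁ _} {_} (inj₁ _) _ _ ()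
  commonNeighbour-unique {inj₂ _} {_} (inj₂ _) _ _ ()
  commonNeighbour-unique {inj₁ _} {inj₂ _} (inj₂ _) _ _ _ ()
  commonNeighbour-unique {inj₂ _} {inj₁ _} (inj₁ _) _ _ _ ()

  twoNeighbours : ∀ x → Σ Vertex λ y → Σ Vertex λ y' → y ≢ y' × Adj x y × Adj x y'
  twoNeighbours (inj₂ L) with twoMembers (line L) (mindeg (inj₂ L))
  ... | p , q , p≢q , pL , qL = inj₁ p , inj₁ q , (λ e → p≢q (inj₁-injective e)) , pL , qL
  twoNeighbours (inj₁ p) with twoMembers (pencil G p) (mindeg (inj₁ p))
  ... | L , L' , L≢L' , pL , pL' =
    inj₂ L , inj₂ L' , (λ e → L≢L' (inj₂-injective e)) , onLine L pL , onLine L' pL'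
    where
      onLine : ∀ L → T (lookup (pencil G p) L) → Adj (inj₁ p) (inj₂ L)
      onLine L = subst T (lookup∘tabulate (λ L → lookup (line L) p) L)

  someVertex : Vertex
  someVertex = inj₁ (fromℕ< P-nonempty)

  searchV : {P : Vertex → Set} → (∀ v → Dec (P v)) → Dec (∃ P)
  searchV P? with any? (λ p → P? (inj₁ p)) | any? (λ L → P? (inj₂ L))
  ... | yes (p , Pp) | _ = yes (inj₁ p , Pp)
  ... | no _ | yes (L , PL) = yes (inj₂ L , PL)
  ... | no ¬P₁ | no ¬P₂ = no λ { (inj₁ p , Pp) → ¬P₁ (p , Pp) ; (inj₂ L , PL) → ¬P₂ (L , PL) }

  singleton-≡ : ∀ x v → T (singleton G x v) → x ≡ v
  singleton-≡ x v t with _≟V_ G x v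
  ... | yes x≡v = x≡v

  singleton-∋ : ∀ x v → x ≡ v → T (singleton G x v)
  singleton-∋ x v x≡v with _≟V_ G x v
  ... | yes _ = tt
  ... | no x≢v = x≢v x≡v

  singleton-small : ∀ x u u' → u ≢ u' → T (singleton G x u) → T (singleton G x u') → ⊥
  singleton-small x u u' u≢u' xu xu' =
    u≢u' (trans (sym (singleton-≡ x u xu)) (singleton-≡ x u' xu'))

  ⊆-refl : ∀ {X} → X ⊆ X
  ⊆-refl _ x = x

  ⊆-trans : ∀ {X Y Z} → X ⊆ Y → Y ⊆ Z → X ⊆ Z
  ⊆-trans X⊆Y Y⊆Z v x = Y⊆Z v (X⊆Y v x)

  ⊂-trans : ∀ {X Y Z} → X ⊂ Y → Y ⊂ Z → X ⊂ Z
  ⊂-trans (X⊆Y , Y⊈X) (Y⊆Z , Z⊈Y) = ⊆-trans X⊆Y Y⊆Z , λ Z⊆X → Z⊈Y (⊆-trans Z⊆X X⊆Y)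

  ≃⇒⊆ : ∀ {X Y} → X ≃ Y → X ⊆ Y
  ≃⇒⊆ X≃Y v = subst T (X≃Y v)

  ≃⇒⊇ : ∀ {X Y} → X ≃ Y → Y ⊆ X
  ≃⇒⊇ X≃Y v = subst T (sym (X≃Y v))

  data Shape : Set where
    whole empty : Shape
    single star : Vertex → Shape

  ⟦_⟧ : Shape → VSet G
  ⟦ whole ⟧    = fullSet G
  ⟦ empty ⟧    = emptySet G
  ⟦ single x ⟧ = singleton G x
  ⟦ star x ⟧   = adj G x

  rank : Shape → ℕ
  rank empty      = 0
  rank (single _) = 1
  rank (star _)   = 2
  rank whole      = 3

  rank≤3 : ∀ s → rank s ≤ 3
  rank≤3 empty      = z≤n
  rank≤3 (single _) = s≤s z≤n
  rank≤3 (star _)   = s≤s (s≤s z≤n)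
  rank≤3 whole      = s≤s (s≤s (s≤s z≤n))

  _IsStOf_ : VSet G → VSet G → Set
  X IsStOf W = ∀ v → T (X v) ⇔ InSt G W v

  -- Every shape is a flat: V = St ∅, ∅ = St V, St x = St {x}, {x} = St(St x).
  shape-flat : ∀ s → IsFlat G ⟦ s ⟧
  shape-flat whole = emptySet G , λ v → mk⇔ (λ _ _ ()) (λ _ → tt)
  shape-flat empty = fullSet G , λ v → mk⇔ (λ ()) (λ inSt → adj-irrefl v (inSt v tt))
  shape-flat (star x) = singleton G x , λ v →
    mk⇔ (λ xv w xw → subst (λ u → Adj u v) (singleton-≡ x w xw) xv)
        (λ inSt → inSt x (singleton-∋ x x refl))
  shape-flat (single x) = adj G x , λ v → mk⇔ (⇒St v) (St⇒ v)
    where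
      ⇒St : ∀ v → T (singleton G x v) → InSt G (adj G x) v
      ⇒St v xv w xw = subst (Adj w) (singleton-≡ x v xv) (adj-sym x w xw)
      St⇒ : ∀ v → InSt G (adj G x) v → T (singleton G x v)
      St⇒ v inSt with twoNeighbours x
      ... | y , y' , y≢y' , xy , xy' = singleton-∋ x v
        (commonNeighbour-unique x v y≢y' (adj-sym x y xy) (adj-sym x y' xy')
                                         (inSt y xy) (inSt y' xy'))

  Class : VSet G → Set
  Class X = Σ Shape λ s → X ≃ ⟦ s ⟧

  class-flat : ∀ {X} → Class X → IsFlat G X
  class-flat {X} (s , X≃s) with shape-flat s
  ... | W , s-St = W , λ v → subst (λ b → T b ⇔ InSt G W v) (sym (X≃s v)) (s-St v)

  St-∅ : ∀ {X W} → (∀ w → ¬ T (W w)) → X IsStOf W → X ≃ fullSet G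
  St-∅ W-empty X-St v =
    T-ext (λ _ → tt) (λ _ → from (X-St v) (λ w w∈W → ⊥-elim (W-empty w w∈W)))

  St-single : ∀ {X W w} → T (W w) → (∀ w' → T (W w') → w' ≡ w) → X IsStOf W → X ≃ adj G w
  St-single {w = w} w∈W W⊆w X-St v =
    T-ext (λ v∈X → to (X-St v) v∈X w w∈W)
          (λ wv → from (X-St v) (λ w' w'∈W → subst (λ u → Adj u v) (sym (W⊆w w' w'∈W)) wv))

  Subsingleton : VSet G → Set
  Subsingleton X = ∀ {u v} → T (X u) → T (X v) → u ≡ v

  St-pair : ∀ {X W w w'} → T (W w) → T (W w') → w ≢ w' → X IsStOf W → Subsingleton X
  St-pair {w = w} {w'} w∈W w'∈W w≢w' X-St {u} {v} u∈X v∈X =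
    commonNeighbour-unique u v w≢w' (to (X-St u) u∈X w w∈W) (to (X-St u) u∈X w' w'∈W)
                                (to (X-St v) v∈X w w∈W) (to (X-St v) v∈X w' w'∈W)

  subsingleton-class : ∀ {X} → Subsingleton X → Class X
  subsingleton-class {X} X-small with searchV (λ v → T? (X v))
  ... | no X-empty = empty , λ v → T-ext (λ v∈X → X-empty (v , v∈X)) (λ ())
  ... | yes (x , x∈X) = single x , λ v →
    T-ext (λ v∈X → singleton-∋ x v (X-small x∈X v∈X))
          (λ xv → subst (λ u → T (X u)) (singleton-≡ x v xv) x∈X)

  classify : ∀ X → IsFlat G X → Class X
  classify X (W , X-St) with searchV (λ w → T? (W w))
  ... | no W-empty = whole , St-∅ (λ w w∈W → W-empty (w , w∈W)) X-St
  ... | yes (w , w∈W) with searchV (λ w' → T? (W w') ×-dec ¬? (_≟V_ G w' w))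
  ...   | no W⊆w = star w , St-single w∈W only-w X-St
    where
      only-w : ∀ w' → T (W w') → w' ≡ w
      only-w w' w'∈W = decidable-stable (_≟V_ G w' w) (λ w'≢w → W⊆w (w' , w'∈W , w'≢w))
  ...   | yes (w' , w'∈W , w'≢w) = subsingleton-class (St-pair w'∈W w∈W w'≢w X-St)

  closed : LeviClosed G
  closed x = shape-flat (single x)

  star-line : ∀ L → adj G (inj₂ L) ≃ lineSet G L
  star-line L (inj₁ _) = refl
  star-line L (inj₂ _) = refl

  star-pencil : ∀ p → adj G (inj₁ p) ≃ pencilSet G p
  star-pencil p (inj₁ _) = refl
  star-pencil p (inj₂ _) = refl

  Listed : VSet G → Set
  Listed X = X ≃ fullSet G ⊎ X ≃ emptySet G ⊎ (∃ λ x → X ≃ singleton G x)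
           ⊎ (∃ λ L → X ≃ lineSet G L) ⊎ (∃ λ p → X ≃ pencilSet G p)

  description : FlDescription G
  description X = mk⇔ (listed ∘ classify X) (class-flat ∘ unlisted)
    where
      listed : Class X → Listed X
      listed (whole , e)          = inj₁ e
      listed (empty , e)          = inj₂ (inj₁ e)
      listed (single x , e)       = inj₂ (inj₂ (inj₁ (x , e)))
      listed (star (inj₂ L) , e)  =
        inj₂ (inj₂ (inj₂ (inj₁ (L , λ v → trans (e v) (star-line L v)))))
      listed (star (inj₁ p) , e)  =
        inj₂ (inj₂ (inj₂ (inj₂ (p , λ v → trans (e v) (star-pencil p v)))))
      unlisted : Listed X → Class X
      unlisted (inj₁ e)                                = whole , e
      unlisted (inj₂ (inj₁ e))                         = empty , e
      unlisted (inj₂ (inj₂ (inj₁ (x , e))))            = single x , e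
      unlisted (inj₂ (inj₂ (inj₂ (inj₁ (L , e)))))     =
        star (inj₂ L) , λ v → trans (e v) (sym (star-line L v))
      unlisted (inj₂ (inj₂ (inj₂ (inj₂ (p , e)))))     =
        star (inj₁ p) , λ v → trans (e v) (sym (star-pencil p v))

  compare : ∀ a b → ⟦ a ⟧ ⊆ ⟦ b ⟧ → rank a < rank b ⊎ (rank a ≡ rank b × ⟦ b ⟧ ⊆ ⟦ a ⟧)
  compare empty empty _ = inj₂ (refl , ⊆-refl)
  compare empty (single _) _ = inj₁ (s≤s z≤n)
  compare empty (star _) _ = inj₁ (s≤s z≤n)
  compare empty whole _ = inj₁ (s≤s z≤n)
  compare (single x) empty x⊆∅ = ⊥-elim (x⊆∅ x (singleton-∋ x x refl))
  compare (single x) (single y) x⊆y = inj₂ (refl , λ v yv →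
    singleton-∋ x v (trans (sym (singleton-≡ y x (x⊆y x (singleton-∋ x x refl))))
                           (singleton-≡ y v yv)))
  compare (single _) (star _) _ = inj₁ (s≤s (s≤s z≤n))
  compare (single _) whole _ = inj₁ (s≤s (s≤s z≤n))
  compare (star x) empty St⊆∅ with twoNeighbours x
  ... | y , _ , _ , xy , _ = ⊥-elim (St⊆∅ y xy)
  compare (star x) (single y) St⊆y with twoNeighbours x
  ... | z , z' , z≢z' , xz , xz' = ⊥-elim (singleton-small y z z' z≢z' (St⊆y z xz) (St⊆y z' xz'))
  compare (star x) (star y) Stx⊆Sty with twoNeighbours x
  ... | z , z' , z≢z' , xz , xz'
    with commonNeighbour-unique x y z≢z' (adj-sym x z xz) (adj-sym x z' xz')
           (adj-sym y z (Stx⊆Sty z xz)) (adj-sym y z' (Stx⊆Sty z' xz'))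
  ...   | refl = inj₂ (refl , ⊆-refl)
  compare (star _) whole _ = inj₁ (s≤s (s≤s (s≤s z≤n)))
  compare whole empty V⊆∅ = ⊥-elim (V⊆∅ someVertex tt)
  compare whole (single y) V⊆y with twoNeighbours y
  ... | z , z' , z≢z' , _ , _ = ⊥-elim (singleton-small y z z' z≢z' (V⊆y z tt) (V⊆y z' tt))
  compare whole (star y) V⊆St = ⊥-elim (adj-irrefl y (V⊆St y tt))
  compare whole whole _ = inj₂ (refl , ⊆-refl)

  interpolate : ∀ a b → ⟦ a ⟧ ⊆ ⟦ b ⟧ → rank a < rank b →
    Σ Shape λ c → ⟦ a ⟧ ⊆ ⟦ c ⟧ × ⟦ c ⟧ ⊆ ⟦ b ⟧ × rank c ≡ suc (rank a)
  interpolate empty (single x) _ _ = single x , (λ _ ()) , ⊆-refl , refl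
  interpolate empty (star x) _ _ with twoNeighbours x
  ... | y , _ , _ , xy , _ =
    single y , (λ _ ()) , (λ v yv → subst (Adj x) (singleton-≡ y v yv) xy) , refl
  interpolate empty whole _ _ = single someVertex , (λ _ ()) , (λ _ _ → tt) , refl
  interpolate (single x) (star y) x⊆St _ = star y , x⊆St , ⊆-refl , refl
  interpolate (single x) whole _ _ with twoNeighbours x
  ... | y , _ , _ , xy , _ =
    star y , (λ v xv → subst (Adj y) (singleton-≡ x v xv) (adj-sym x y xy)) , (λ _ _ → tt) , refl
  interpolate (star x) whole St⊆V _ = whole , St⊆V , ⊆-refl , refl
  interpolate empty empty _ ()
  interpolate (single _) empty _ ()
  interpolate (single _) (single _) _ (s≤s ())
  interpolate (star _) empty _ ()
  interpolate (star _) (single _) _ (s≤s ())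
  interpolate (star _) (star _) _ (s≤s (s≤s ()))
  interpolate whole empty _ ()
  interpolate whole (single _) _ (s≤s ())
  interpolate whole (star _) _ (s≤s (s≤s ()))
  interpolate whole whole _ (s≤s (s≤s (s≤s ())))

  rankOf : ∀ {X} → Class X → ℕ
  rankOf (a , _) = rank a

  canonical : ∀ s → Class ⟦ s ⟧
  canonical s = s , λ _ → refl

  shapes-⊆ : ∀ {X Y} → X ⊆ Y → (cX : Class X) (cY : Class Y) → ⟦ proj₁ cX ⟧ ⊆ ⟦ proj₁ cY ⟧
  shapes-⊆ X⊆Y (_ , X≃a) (_ , Y≃b) = ⊆-trans (≃⇒⊇ X≃a) (⊆-trans X⊆Y (≃⇒⊆ Y≃b))

  ⊆-rank : ∀ {X Y} → X ⊆ Y → (cX : Class X) (cY : Class Y) → rankOf cX ≤ rankOf cY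
  ⊆-rank X⊆Y cX cY with compare (proj₁ cX) (proj₁ cY) (shapes-⊆ X⊆Y cX cY)
  ... | inj₁ lt = <⇒≤ lt
  ... | inj₂ (eq , _) = ≤-reflexive eq

  ⊂-rank : ∀ {X Y} → X ⊂ Y → (cX : Class X) (cY : Class Y) → rankOf cX < rankOf cY
  ⊂-rank (X⊆Y , Y⊈X) (a , X≃a) (b , Y≃b) with compare a b (shapes-⊆ X⊆Y (a , X≃a) (b , Y≃b))
  ... | inj₁ lt = lt
  ... | inj₂ (_ , b⊆a) = ⊥-elim (Y⊈X (⊆-trans (≃⇒⊆ Y≃b) (⊆-trans b⊆a (≃⇒⊇ X≃a))))

  <-rank⇒⊉ : ∀ {X Y} (cX : Class X) (cY : Class Y) → rankOf cX < rankOf cY → ¬ (Y ⊆ X)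
  <-rank⇒⊉ cX cY lt Y⊆X = <⇒≱ lt (⊆-rank Y⊆X cY cX)

  Comparable : VSet G → VSet G → Set
  Comparable Y W = W ⊆ Y ⊎ Y ⊆ W

  MaximalAbove : VSet G → List (VSet G) → Set
  MaximalAbove X rest = ∀ Y → IsFlat G Y → X ⊆ Y → All (Comparable Y) rest → Any (_≃ Y) (X ∷ rest)

  maximalAbove-head : ∀ {X rest} → IsMaximalChain G (X ∷ rest) → MaximalAbove X rest
  maximalAbove-head (_ , maximal) Y Y-flat X⊆Y comparable =
    maximal Y Y-flat (inj₁ X⊆Y ∷ comparable)

  aboveHead : ∀ {X rest} → Linked _⊂_ (X ∷ rest) → All (X ⊂_) rest
  aboveHead [-] = []
  aboveHead (X⊂Z ∷ chain) = Linked⇒All ⊂-trans X⊂Z chain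

  maximalAbove-tail : ∀ {X Z rest} → X ⊂ Z → MaximalAbove X (Z ∷ rest) → MaximalAbove Z rest
  maximalAbove-tail (X⊆Z , Z⊈X) maximal Y Y-flat Z⊆Y comparable
    with maximal Y Y-flat (⊆-trans X⊆Z Z⊆Y) (inj₁ Z⊆Y ∷ comparable)
  ... | here X≃Y = ⊥-elim (Z⊈X (⊆-trans Z⊆Y (≃⇒⊇ X≃Y)))
  ... | there inRest = inRest

  -- A shape above X, of larger rank, and strictly below every member of
  -- `rest` would extend the chain; so there is none.
  noShapeAbove : ∀ {X rest} → MaximalAbove X rest → (cX : Class X) (c : Shape) →
    X ⊆ ⟦ c ⟧ → rankOf cX < rank c → All (⟦ c ⟧ ⊂_) rest → ⊥
  noShapeAbove maximal cX c X⊆c lt c⊂rest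
    with maximal ⟦ c ⟧ (shape-flat c) X⊆c (All.map (λ c⊂W → inj₂ (proj₁ c⊂W)) c⊂rest)
  ... | here X≃c = <-rank⇒⊉ cX (canonical c) lt (≃⇒⊇ X≃c)
  ... | there inRest = lookupWith (λ c⊂W W≃c → proj₂ c⊂W (≃⇒⊆ W≃c)) c⊂rest inRest

  top-rank : ∀ {X} → MaximalAbove X [] → (cX : Class X) → rankOf cX ≡ 3
  top-rank maximal cX with m≤n⇒m<n∨m≡n (rank≤3 (proj₁ cX))
  ... | inj₂ r≡3 = r≡3
  ... | inj₁ r<3 with interpolate (proj₁ cX) whole (λ _ _ → tt) r<3
  ...   | c , a⊆c , _ , rank-c = ⊥-elim
    (noShapeAbove maximal cX c (⊆-trans (≃⇒⊆ (proj₂ cX)) a⊆c) (≤-reflexive (sym rank-c)) [])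

  consecutive : ∀ {X Z rest} → MaximalAbove X (Z ∷ rest) → Linked _⊂_ (X ∷ Z ∷ rest) →
    (cX : Class X) (cZ : Class Z) → rankOf cZ ≡ suc (rankOf cX)
  consecutive {Z = Z} maximal (X⊂Z ∷ chain) cX cZ with m≤n⇒m<n∨m≡n (⊂-rank X⊂Z cX cZ)
  ... | inj₂ e = sym e
  ... | inj₁ gap
    with interpolate (proj₁ cX) (proj₁ cZ) (shapes-⊆ (proj₁ X⊂Z) cX cZ) (⊂-rank X⊂Z cX cZ)
  ...   | c , a⊆c , c⊆b , rank-c = ⊥-elim
    (noShapeAbove maximal cX c (⊆-trans (≃⇒⊆ (proj₂ cX)) a⊆c) (≤-reflexive (sym rank-c))
                  (Linked⇒All ⊂-trans c⊂Z chain))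
    where
      c⊂Z : ⟦ c ⟧ ⊂ Z
      c⊂Z = ⊆-trans c⊆b (≃⇒⊇ (proj₂ cZ))
          , <-rank⇒⊉ (canonical c) cZ (subst (_< rankOf cZ) (sym rank-c) gap)

  chainLength : ∀ X rest (cX : Class X) → All (IsFlat G) rest → Linked _⊂_ (X ∷ rest) →
    MaximalAbove X rest → length rest + rankOf cX ≡ 3
  chainLength X [] cX _ _ maximal = top-rank maximal cX
  chainLength X (Z ∷ rest) cX (Z-flat ∷ flats) chain@(X⊂Z ∷ chain') maximal = begin
    suc (length rest) + rankOf cX  ≡⟨ sym (+-suc (length rest) (rankOf cX)) ⟩
    length rest + suc (rankOf cX)  ≡⟨ cong (length rest +_) (sym (consecutive maximal chain cX cZ)) ⟩
    length rest + rankOf cZ        ≡⟨ chainLength Z rest cZ flats chain' (maximalAbove-tail X⊂Z maximal) ⟩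
    3                              ∎
    where
      open ≡-Reasoning
      cZ : Class Z
      cZ = classify Z Z-flat

  bottom-rank : ∀ {X rest} → IsMaximalChain G (X ∷ rest) → (cX : Class X) → rankOf cX ≡ 0
  bottom-rank {X} {rest} ((_ , chain) , maximal) cX = n≤0⇒n≡0 (⊆-rank X⊆∅ cX (canonical empty))
    where
      X⊆∅ : X ⊆ emptySet G
      X⊆∅ with maximal (emptySet G) (shape-flat empty) (universal (λ _ → inj₂ (λ _ ())) (X ∷ rest))
      ... | here X≃∅ = ≃⇒⊆ X≃∅
      ... | there inRest =
        lookupWith (λ X⊂W W≃∅ → ⊆-trans (proj₁ X⊂W) (≃⇒⊆ W≃∅)) (aboveHead chain) inRest

  -- A maximal chain climbs from rank 0 to rank 3, so it has four members.
  maximalChain-length : ∀ c → IsMaximalChain G c → length c ≡ 4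
  maximalChain-length [] (_ , maximal) with maximal (fullSet G) (shape-flat whole) []
  ... | ()
  maximalChain-length (X ∷ rest) maximal@((X-flat ∷ flats , chain) , _) = cong suc (begin
    length rest                   ≡⟨ sym (+-identityʳ (length rest)) ⟩
    length rest + 0               ≡⟨ cong (length rest +_) (sym (bottom-rank maximal cX)) ⟩
    length rest + rankOf cX       ≡⟨ chainLength X rest cX flats chain (maximalAbove-head maximal) ⟩
    3                             ∎)
    where
      open ≡-Reasoning
      cX : Class X
      cX = classify X X-flat

  jordanDedekind : JordanDedekind G
  jordanDedekind c c' maximal maximal' =
    trans (maximalChain-length c maximal) (sym (maximalChain-length c' maximal'))

theorem6p13 : ∀ {n m : ℕ} (G : PEG n m) → Connected G → MindegAtLeast2 G →
    LeviClosed G × FlDescription G × JordanDedekind G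
theorem6p13 G _ mindeg = closed , description , jordanDedekind
  where open Levi G mindeg
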